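{- Let $a$ be an even integer with $a>2$ and $S=\langle a,a+1,a+2\rangle$. Then every $r\in S$ can be expressed as $r=\lambda a+\mu(a+1)+\eta(a+2)$ with $\lambda\in\mathbb{N}$, $\mu\in\{0,1\}$ and $\eta\in\{0,1,\dots,a/2-1\}$. Moreover, $\operatorname{Ap}(S,\operatorname{UBetti}(S))=\{\lambda a+\mu(a+1)+\eta(a+2):\lambda\in\{0,\dots,a/2\},\ \mu\in\{0,1\},\ \eta\in\{0,\dots,a/2-1\}\}.$
   Context: $\mathbb{N}=\{0,1,2,\dots\}$; $S=\langle a,a+1,a+2\rangle=\{\alpha_1a+\alpha_2(a+1)+\alpha_3(a+2):\alpha_i\in\mathbb{N}\}$. For $r\in S$, $\operatorname{F}(r,S)=\{\alpha\in\mathbb{N}^3:\alpha_1a+\alpha_2(a+1)+\alpha_3(a+2)=r\}$, $|\alpha|=\alpha_1+\alpha_2+\alpha_3$, $\operatorname{L}(r,S)=\{|\alpha|:\alpha\in\operatorname{F}(r,S)\}$, $\operatorname{ULF}(S)=\{r\in S:|\operatorname{L}(r,S)|=1\}$. For $r\in S$, $\nabla_r$ is the graph on $\operatorname{F}(r,S)$ where two vertices are adjacent iff their dot product is nonzero; $r$ is a Betti element if $\nabla_r$ is disconnected; $\operatorname{UBetti}(S)$ is the set of Betti elements of $S$ not in $\operatorname{ULF}(S)$. For $X\subseteq S\setminus\{0\}$, $\operatorname{Ap}(S,X)=\{s\in S:s-x\notin S\text{ for all }x\in X\}$. -}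

module Defs where

open import Data.Nat using (ℕ; zero; suc; _+_; _*_; _∸_; _≤_; _<_)
open import Data.Product using (Σ; _×_; _,_; ∃; ∃-syntax)
open import Relation.Nullary using (¬_)
open import Relation.Binary.PropositionalEquality using (_≡_; _≢_)

ℕ³ : Set
ℕ³ = ℕ × ℕ × ℕ

eval : ℕ → ℕ³ → ℕ
eval a (α₁ , α₂ , α₃) = α₁ * a + α₂ * (a + 1) + α₃ * (a + 2)

len : ℕ³ → ℕ
len (α₁ , α₂ , α₃) = α₁ + α₂ + α₃

dot : ℕ³ → ℕ³ → ℕ
dot (α₁ , α₂ , α₃) (β₁ , β₂ , β₃) = α₁ * β₁ + α₂ * β₂ + α₃ * β₃

IsFact : ℕ → ℕ → ℕ³ → Set
IsFact a r α = eval a α ≡ r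

InS : ℕ → ℕ → Set
InS a r = ∃[ α ] IsFact a r α

-- r ∈ ULF(S): r ∈ S and L(r,S) is a singleton
-- (L(r,S) is nonempty since r ∈ S, so |L| = 1 iff all lengths coincide)
ULF : ℕ → ℕ → Set
ULF a r = InS a r × (∀ α β → IsFact a r α → IsFact a r β → len α ≡ len β)

Adj : ℕ³ → ℕ³ → Set
Adj α β = dot α β ≢ 0

data Reach (a r : ℕ) : ℕ³ → ℕ³ → Set where
  here : ∀ {α} → Reach a r α α
  step : ∀ {α β γ} → IsFact a r β → Adj α β → Reach a r β γ → Reach a r α γ

Connected : ℕ → ℕ → Set
Connected a r = ∀ α β → IsFact a r α → IsFact a r β → Reach a r α β

Betti : ℕ → ℕ → Set
Betti a r = InS a r × ¬ Connected a r

UBetti : ℕ → ℕ → Set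
UBetti a r = Betti a r × ¬ ULF a r

-- Ap(S,X) = {s ∈ S : s - x ∉ S for all x ∈ X}; s - x ∈ S (integers)
-- means x ≤ s and s ∸ x ∈ S.
Ap : ℕ → (ℕ → Set) → ℕ → Set
Ap a X s = InS a s × (∀ x → X x → ¬ (x ≤ s × InS a (s ∸ x)))

{-# OPTIONS --safe #-}
module Submission where

open import Defs
open import Data.Nat using (ℕ; zero; suc; _+_; _*_; _∸_; _≤_; _<_; _/_; _%_; z≤n; s≤s; NonZero; >-nonZero⁻¹; _<?_; _≤?_)
open import Data.Nat.Properties
open import Data.Nat.DivMod using (m≡m%n+[m/n]*n; m%n<n; m*n/n≡m; [m+kn]%n≡m%n; m<n⇒m%n≡m; +-distrib-/-∣ʳ; m<n⇒m/n≡0)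
open import Data.Nat.Divisibility using (_∣_; divides; n∣m*n)
open import Data.Product using (_×_; ∃-syntax; _,_)
open import Data.Sum using (_⊎_; inj₁; inj₂; [_,_]′)
open import Data.Empty using (⊥-elim)
open import Relation.Nullary using (¬_; yes; no)
open import Relation.Binary.PropositionalEquality
open import Data.Nat.Tactic.RingSolver using (solve-∀)

-- Write a = 2k. The relations 2(a+1) = a + (a+2) and k(a+2) = (k+1)a rewrite every
-- factorization into a normal form λa + μ(a+1) + η(a+2) with μ ≤ 1 and η < k, which is
-- unique because its weight μ + 2η < a is the remainder of the element modulo a. The first
-- relation preserves length, so two factorizations of r have different lengths only if the
-- second relation is needed, i.e. only if r − b ∈ S for b = (k+1)a. This b is itself in
-- UBetti(S): its factorizations (k+1,0,0) and (0,0,k) have different lengths, and the first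
-- is isolated in ∇_b because k a has no factorization besides (k,0,0). Hence
-- Ap(S, UBetti(S)) = Ap(S, {b}), which consists of the normal forms with λ ≤ k.

infixl 6 _⊕_
_⊕_ : ℕ³ → ℕ³ → ℕ³
(x , y , z) ⊕ (x′ , y′ , z′) = (x + x′ , y + y′ , z + z′)

eval-⊕ : ∀ a α β → eval a α + eval a β ≡ eval a (α ⊕ β)
eval-⊕ a (x , y , z) (x′ , y′ , z′) = identity a x y z x′ y′ z′
  where
  identity : ∀ a x y z x′ y′ z′ →
    (x * a + y * (a + 1) + z * (a + 2)) + (x′ * a + y′ * (a + 1) + z′ * (a + 2))
      ≡ (x + x′) * a + (y + y′) * (a + 1) + (z + z′) * (a + 2)
  identity = solve-∀

eval-suc : ∀ a x y z → eval a (suc x , y , z) ≡ a + eval a (x , y , z)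
eval-suc = identity
  where
  identity : ∀ a x y z →
    suc x * a + y * (a + 1) + z * (a + 2) ≡ a + (x * a + y * (a + 1) + z * (a + 2))
  identity = solve-∀

eval≡weight+len*a : ∀ a x y z → eval a (x , y , z) ≡ (y + z * 2) + len (x , y , z) * a
eval≡weight+len*a = identity
  where
  identity : ∀ a x y z →
    x * a + y * (a + 1) + z * (a + 2) ≡ (y + z * 2) + (x + y + z) * a
  identity = solve-∀

eval-trade-pairs : ∀ a x m j z → eval a (x , m + j * 2 , z) ≡ eval a (x + j , m , z + j)
eval-trade-pairs = identity
  where
  identity : ∀ a x m j z →
    x * a + (m + j * 2) * (a + 1) + z * (a + 2) ≡ (x + j) * a + m * (a + 1) + (z + j) * (a + 2)
  identity = solve-∀

len-trade-pairs : ∀ x m j z → len (x , m + j * 2 , z) ≡ len (x + j , m , z + j)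
len-trade-pairs = identity
  where
  identity : ∀ x m j z → x + (m + j * 2) + z ≡ (x + j) + m + (z + j)
  identity = solve-∀

remainder-unique : ∀ {n r} q .{{_ : NonZero n}} → r < n → (r + q * n) % n ≡ r
remainder-unique {n} {r} q r<n = trans ([m+kn]%n≡m%n r q n) (m<n⇒m%n≡m r<n)

quotient-unique : ∀ {n r} q .{{_ : NonZero n}} → r < n → (r + q * n) / n ≡ q
quotient-unique {n} {r} q r<n = begin
  (r + q * n) / n    ≡⟨ +-distrib-/-∣ʳ r (n∣m*n q) ⟩
  r / n + q * n / n  ≡⟨ cong₂ _+_ (m<n⇒m/n≡0 r<n) (m*n/n≡m q n) ⟩
  q                  ∎
  where open ≡-Reasoning

remainder-quotient-unique : ∀ {n r r′ q q′} .{{_ : NonZero n}} → r < n → r′ < n →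
  r + q * n ≡ r′ + q′ * n → r ≡ r′ × q ≡ q′
remainder-quotient-unique {q = q} {q′} r<n r′<n eq =
  trans (sym (remainder-unique q r<n)) (trans (cong (_% _) eq) (remainder-unique q′ r′<n)) ,
  trans (sym (quotient-unique q r<n)) (trans (cong (_/ _) eq) (quotient-unique q′ r′<n))

trade-pairs : ∀ a α → ∃[ x ] ∃[ m ] ∃[ z ]
  (m ≤ 1 × eval a α ≡ eval a (x , m , z) × len α ≡ len (x , m , z))
trade-pairs a (x , y , z) =
  x + j , m , z + j , ≤-pred (m%n<n y 2) ,
  trans (cong (λ y → eval a (x , y , z)) y≡m+j*2) (eval-trade-pairs a x m j z) ,
  trans (cong (λ y → len (x , y , z)) y≡m+j*2) (len-trade-pairs x m j z)
  where
  m j : ℕ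
  m = y % 2
  j = y / 2
  y≡m+j*2 : y ≡ m + j * 2
  y≡m+j*2 = m≡m%n+[m/n]*n y 2

module SemigroupOrder (a : ℕ) where

  infix 4 _≼_
  _≼_ : ℕ → ℕ → Set
  x ≼ s = ∃[ t ] (x + eval a t ≡ s)

  ≼-trans : ∀ {x y s} → x ≼ y → y ≼ s → x ≼ s
  ≼-trans {x} (t , refl) (u , refl) =
    t ⊕ u , trans (cong (x +_) (sym (eval-⊕ a t u))) (sym (+-assoc x (eval a t) (eval a u)))

  ≼⇒≤×∸∈S : ∀ {x s} → x ≼ s → x ≤ s × InS a (s ∸ x)
  ≼⇒≤×∸∈S {x} (t , refl) = m≤m+n x (eval a t) , t , sym (m+n∸m≡n x (eval a t))

  ≤×∸∈S⇒≼ : ∀ {x s} → x ≤ s × InS a (s ∸ x) → x ≼ s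
  ≤×∸∈S⇒≼ {x} (x≤s , t , t∈F) = t , trans (cong (x +_) t∈F) (m+[n∸m]≡n x≤s)

module Even (k : ℕ) .{{_ : NonZero k}} where

  a : ℕ
  a = k * 2

  instance
    a-nonZero : NonZero a
    a-nonZero = m*n≢0 k 2

  open SemigroupOrder a
  open ≡-Reasoning

  betti-via-a : ℕ³
  betti-via-a = (suc k , 0 , 0)

  betti : ℕ
  betti = eval a betti-via-a

  eval-trade-blocks : ∀ x m e i → eval a (x , m , e + i * k) ≡ eval a (x + i * suc k , m , e)
  eval-trade-blocks = identity k
    where
    identity : ∀ k x m e i →
      x * (k * 2) + m * (k * 2 + 1) + (e + i * k) * (k * 2 + 2)
        ≡ (x + i * suc k) * (k * 2) + m * (k * 2 + 1) + e * (k * 2 + 2)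
    identity = solve-∀

  eval-trade-block : ∀ x m d → eval a (x , m , k + d) ≡ eval a (suc k + x , m , d)
  eval-trade-block = identity k
    where
    identity : ∀ k x m d →
      x * (k * 2) + m * (k * 2 + 1) + (k + d) * (k * 2 + 2)
        ≡ (suc k + x) * (k * 2) + m * (k * 2 + 1) + d * (k * 2 + 2)
    identity = solve-∀

  betti≡eval-0-0-k : betti ≡ eval a (0 , 0 , k)
  betti≡eval-0-0-k = identity k
    where
    identity : ∀ k →
      suc k * (k * 2) + 0 * (k * 2 + 1) + 0 * (k * 2 + 2)
        ≡ 0 * (k * 2) + 0 * (k * 2 + 1) + k * (k * 2 + 2)
    identity = solve-∀

  weight<a : ∀ {m e} → m ≤ 1 → e < k → m + e * 2 < a
  weight<a {e = e} m≤1 e<k = <-≤-trans (+-monoˡ-< (e * 2) (s≤s m≤1)) (*-monoˡ-≤ 2 e<k)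

  normal-form : ∀ α → ∃[ l ] ∃[ m ] ∃[ e ] (m ≤ 1 × e < k × eval a α ≡ eval a (l , m , e))
  normal-form α with trade-pairs a α
  ... | x , m , z , m≤1 , α≡ , _ =
    x + i * suc k , m , e , m≤1 , m%n<n z k ,
    trans α≡ (trans (cong (λ z → eval a (x , m , z)) (m≡m%n+[m/n]*n z k)) (eval-trade-blocks x m e i))
    where
    e i : ℕ
    e = z % k
    i = z / k

  normal-form-unique : ∀ l m e l′ m′ e′ → m ≤ 1 → e < k → m′ ≤ 1 → e′ < k →
    eval a (l , m , e) ≡ eval a (l′ , m′ , e′) → (l , m , e) ≡ (l′ , m′ , e′)
  normal-form-unique l m e l′ m′ e′ m≤1 e<k m′≤1 e′<k eq
    with remainder-quotient-unique {q = len (l , m , e)} {len (l′ , m′ , e′)}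
           (weight<a m≤1 e<k) (weight<a m′≤1 e′<k)
           (trans (sym (eval≡weight+len*a a l m e)) (trans eq (eval≡weight+len*a a l′ m′ e′)))
  ... | weights≡ , lens≡
    with remainder-quotient-unique {q = e} {e′} (s≤s m≤1) (s≤s m′≤1) weights≡
  ... | refl , refl = cong (_, m , e) (+-cancelʳ-≡ m l l′ (+-cancelʳ-≡ e _ _ lens≡))

  length-preserving-normal-form⊎betti≼ : ∀ α →
    (∃[ l ] ∃[ m ] ∃[ e ] (m ≤ 1 × e < k × eval a α ≡ eval a (l , m , e) × len α ≡ len (l , m , e)))
    ⊎ betti ≼ eval a α
  length-preserving-normal-form⊎betti≼ α with trade-pairs a α
  ... | x , m , z , m≤1 , α≡ , len≡ with z <? k
  ...   | yes z<k = inj₁ (x , m , z , m≤1 , z<k , α≡ , len≡)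
  ...   | no z≮k with m≤n⇒∃[o]m+o≡n (≮⇒≥ z≮k)
  ...     | d , refl = inj₂ ((x , m , d) , (begin
    betti + eval a (x , m , d)  ≡⟨ eval-⊕ a betti-via-a (x , m , d) ⟩
    eval a (suc k + x , m , d)  ≡⟨ eval-trade-block x m d ⟨
    eval a (x , m , k + d)      ≡⟨ α≡ ⟨
    eval a α                    ∎))

  betti⋠normal-form : ∀ {l m e} → l ≤ k → m ≤ 1 → e < k → ¬ betti ≼ eval a (l , m , e)
  betti⋠normal-form {l} {m} {e} l≤k m≤1 e<k (t , betti+t≡) with normal-form t
  ... | g₁ , g₂ , g₃ , g₂≤1 , g₃<k , t≡g
    with normal-form-unique (suc k + g₁) g₂ g₃ l m e g₂≤1 g₃<k m≤1 e<k (begin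
      eval a (suc k + g₁ , g₂ , g₃)  ≡⟨ eval-⊕ a betti-via-a (g₁ , g₂ , g₃) ⟨
      betti + eval a (g₁ , g₂ , g₃)  ≡⟨ cong (betti +_) t≡g ⟨
      betti + eval a t               ≡⟨ betti+t≡ ⟩
      eval a (l , m , e)             ∎)
  ... | refl = <⇒≱ (m≤m+n (suc k) g₁) l≤k

  lengths-agree⊎betti≼ : ∀ α β → eval a α ≡ eval a β → len α ≡ len β ⊎ betti ≼ eval a α
  lengths-agree⊎betti≼ α β α≡β
    with length-preserving-normal-form⊎betti≼ α | length-preserving-normal-form⊎betti≼ β
  ... | inj₂ betti≼α | _ = inj₂ betti≼α
  ... | inj₁ _ | inj₂ betti≼β = inj₂ (subst (betti ≼_) (sym α≡β) betti≼β)
  ... | inj₁ (l , m , e , m≤1 , e<k , α≡ , lenα) | inj₁ (l′ , m′ , e′ , m′≤1 , e′<k , β≡ , lenβ)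
    with normal-form-unique l m e l′ m′ e′ m≤1 e<k m′≤1 e′<k (trans (sym α≡) (trans α≡β β≡))
  ...   | refl = inj₁ (trans lenα (sym lenβ))

  ULF-if-betti⋠ : ∀ {r} → InS a r → ¬ betti ≼ r → ULF a r
  ULF-if-betti⋠ r∈S betti⋠r = r∈S , λ α β α∈F β∈F →
    [ (λ len≡ → len≡) , (λ betti≼α → ⊥-elim (betti⋠r (subst (betti ≼_) α∈F betti≼α))) ]′
      (lengths-agree⊎betti≼ α β (trans α∈F (sym β∈F)))

  unique-factorisation-of-k*a : ∀ {β} → eval a β ≡ eval a (k , 0 , 0) → β ≡ (k , 0 , 0)
  unique-factorisation-of-k*a {β@(x , y , z)} β≡ with length-preserving-normal-form⊎betti≼ β
  ... | inj₂ betti≼β = ⊥-elim (betti⋠normal-form ≤-refl z≤n (>-nonZero⁻¹ k) (subst (betti ≼_) β≡ betti≼β))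
  ... | inj₁ (l , m , e , m≤1 , e<k , β≡ν , lenβ)
    with normal-form-unique l m e k 0 0 m≤1 e<k z≤n (>-nonZero⁻¹ k) (trans (sym β≡ν) β≡)
  ... | refl with m+n≡0⇒m≡0 y weight≡0 | m*n≡0⇒m≡0 z 2 (m+n≡0⇒n≡0 y weight≡0)
    where
    weight≡0 : y + z * 2 ≡ 0
    weight≡0 = +-cancelʳ-≡ (len β * a) (y + z * 2) 0 (begin
      (y + z * 2) + len β * a    ≡⟨ eval≡weight+len*a a x y z ⟨
      eval a β                   ≡⟨ β≡ ⟩
      eval a (k , 0 , 0)         ≡⟨ eval≡weight+len*a a k 0 0 ⟩
      0 + len (k , 0 , 0) * a    ≡⟨ cong (λ n → 0 + n * a) lenβ ⟨
      0 + len β * a              ∎)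
  ... | refl | refl = cong (_, 0 , 0) (+-cancelʳ-≡ 0 x k (+-cancelʳ-≡ 0 _ _ lenβ))

  betti-via-a-isolated : ∀ {β} → IsFact a betti β → Adj betti-via-a β → β ≡ betti-via-a
  betti-via-a-isolated {zero , y , z} _ adj = ⊥-elim (adj (cong (λ n → n + 0 + 0) (*-zeroʳ (suc k))))
  betti-via-a-isolated {suc x , y , z} β∈F _ =
    cong (λ { (x , y , z) → (suc x , y , z) }) (unique-factorisation-of-k*a (+-cancelˡ-≡ a _ _ (begin
      a + eval a (x , y , z)   ≡⟨ eval-suc a x y z ⟨
      eval a (suc x , y , z)   ≡⟨ β∈F ⟩
      betti                    ≡⟨ eval-suc a k 0 0 ⟩
      a + eval a (k , 0 , 0)   ∎)))

  reachable-from-betti-via-a : ∀ {γ} → Reach a betti betti-via-a γ → γ ≡ betti-via-a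
  reachable-from-betti-via-a here = refl
  reachable-from-betti-via-a (step {β = β} β∈F adj path) with betti-via-a-isolated {β} β∈F adj
  ... | refl = reachable-from-betti-via-a path

  betti∈UBetti : UBetti a betti
  betti∈UBetti = (betti∈S , ∇-disconnected) , ¬ULF
    where
    betti∈S : InS a betti
    betti∈S = betti-via-a , refl

    ∇-disconnected : ¬ Connected a betti
    ∇-disconnected connected
      with reachable-from-betti-via-a (connected betti-via-a (0 , 0 , k) refl (sym betti≡eval-0-0-k))
    ... | ()

    ¬ULF : ¬ ULF a betti
    ¬ULF (_ , lengths-agree) = 1+n≢n (begin
      suc k            ≡⟨ +-identityʳ (suc k) ⟨
      suc k + 0        ≡⟨ +-identityʳ (suc k + 0) ⟨
      len betti-via-a  ≡⟨ lengths-agree betti-via-a (0 , 0 , k) refl (sym betti≡eval-0-0-k) ⟩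
      len (0 , 0 , k)  ∎)

  normal-form-with-l≤k⇒Ap : ∀ {l m e} → l ≤ k → m ≤ 1 → e < k → Ap a (UBetti a) (eval a (l , m , e))
  normal-form-with-l≤k⇒Ap {l} {m} {e} l≤k m≤1 e<k =
    ((l , m , e) , refl) , λ { x ((x∈S , _) , ¬ULF) x≤s×s∸x∈S →
      ¬ULF (ULF-if-betti⋠ x∈S λ betti≼x →
        betti⋠normal-form l≤k m≤1 e<k (≼-trans {betti} {x} betti≼x (≤×∸∈S⇒≼ x≤s×s∸x∈S))) }

  Ap⇒normal-form-with-l≤k : ∀ {s} → Ap a (UBetti a) s →
    ∃[ l ] ∃[ m ] ∃[ e ] (l ≤ k × m ≤ 1 × e < k × s ≡ eval a (l , m , e))
  Ap⇒normal-form-with-l≤k ((α , refl) , betti-unremovable) with normal-form α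
  ... | l , m , e , m≤1 , e<k , α≡ with l ≤? k
  ...   | yes l≤k = l , m , e , l≤k , m≤1 , e<k , α≡
  ...   | no l≰k with m≤n⇒∃[o]m+o≡n (≰⇒> l≰k)
  ...     | d , refl = ⊥-elim (betti-unremovable betti betti∈UBetti (≼⇒≤×∸∈S betti≼α))
    where
    betti≼α : betti ≼ eval a α
    betti≼α = (d , m , e) , trans (eval-⊕ a betti-via-a (d , m , e)) (sym α≡)

lemma5p1 : (a : ℕ) → 2 ∣ a → 2 < a →
    ((r : ℕ) → InS a r →
      ∃[ l ] ∃[ m ] ∃[ e ] (m ≤ 1 × e < a / 2 × r ≡ l * a + m * (a + 1) + e * (a + 2)))
    × ((s : ℕ) →
      (Ap a (UBetti a) s →
        ∃[ l ] ∃[ m ] ∃[ e ] (l ≤ a / 2 × m ≤ 1 × e < a / 2 × s ≡ l * a + m * (a + 1) + e * (a + 2)))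
      × ((∃[ l ] ∃[ m ] ∃[ e ] (l ≤ a / 2 × m ≤ 1 × e < a / 2 × s ≡ l * a + m * (a + 1) + e * (a + 2)))
        → Ap a (UBetti a) s))
-- The hypothesis 2 < a only rules out a = 0; the argument also covers a = 2.
lemma5p1 _ (divides zero refl) ()
lemma5p1 _ (divides k@(suc _) refl) _ rewrite m*n/n≡m k 2 ⦃ _ ⦄ =
  (λ { _ (α , refl) → normal-form α }) ,
  λ _ → Ap⇒normal-form-with-l≤k ,
        λ { (_ , _ , _ , l≤k , m≤1 , e<k , refl) → normal-form-with-l≤k⇒Ap l≤k m≤1 e<k }
  where open Even k
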